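{- Let $s \ge 2$ and $n \ge 1$ be integers, and let $\mathcal{F}_1, \ldots, \mathcal{F}_s$ be a cross saturated sequence of families of subsets of $[n]$. Then $|\mathcal{F}_1| + \cdots + |\mathcal{F}_s| \ge (s-1)\,2^n$.
   Context: $[n] = \{1,\ldots,n\}$. A sequence of $s$ families $\mathcal{F}_1, \ldots, \mathcal{F}_s$ of subsets of $[n]$ is called cross dependant if there is no choice of sets $A_i \in \mathcal{F}_i$ for $i \in [s]$ such that $A_1, \ldots, A_s$ are pairwise disjoint. The sequence is called cross saturated if it is cross dependant and is maximal with respect to this property, i.e. for every $i \in [s]$ and every subset $A \subseteq [n]$ with $A \notin \mathcal{F}_i$, the sequence obtained by replacing $\mathcal{F}_i$ with $\mathcal{F}_i \cup \{A\}$ is not cross dependant. -}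

module Defs where

open import Data.Nat using (ℕ; zero; suc)
open import Data.Bool using (Bool; true; false)
open import Data.Fin using (Fin; _≟_)
open import Data.Fin.Subset using (Subset; _∩_; Empty)
open import Data.Vec using ([]; _∷_)
open import Data.Vec.Properties using (≡-dec)
import Data.Bool
open import Data.List using (List; []; _∷_; map; _++_; length; filterᵇ)
open import Data.Product using (Σ; _×_)
open import Relation.Nullary using (¬_; yes; no)
open import Relation.Binary.PropositionalEquality using (_≡_; _≢_)

-- A family of subsets of [n] = {0,…,n-1} (Fin n), given by its (Boolean) membership function.
Family : ℕ → Set
Family n = Subset n → Bool

allSubsets : (n : ℕ) → List (Subset n)
allSubsets zero = [] ∷ []
allSubsets (suc n) = map (false ∷_) (allSubsets n) ++ map (true ∷_) (allSubsets n)

card : {n : ℕ} → Family n → ℕ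
card {n} F = length (filterᵇ F (allSubsets n))

CrossDependant : {s n : ℕ} → (Fin s → Family n) → Set
CrossDependant {s} {n} F =
  ¬ (Σ (Fin s → Subset n) λ A →
       ((i : Fin s) → F i (A i) ≡ true) ×
       ((i j : Fin s) → i ≢ j → Empty (A i ∩ A j)))

addSet : {s n : ℕ} → (Fin s → Family n) → Fin s → Subset n → (Fin s → Family n)
addSet F i A j B with j ≟ i
... | no _ = F j B
... | yes _ with ≡-dec Data.Bool._≟_ B A
...   | yes _ = true
...   | no _ = F j B

CrossSaturated : {s n : ℕ} → (Fin s → Family n) → Set
CrossSaturated {s} {n} F =
  CrossDependant F ×
  ((i : Fin s) (A : Subset n) → F i A ≡ false → ¬ CrossDependant (addSet F i A))

-- For each i let J i (resp. K i) be the up-closed family of sets containing pairwise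
-- disjoint members of the F k with k < i (resp. k > i). If A ∉ F i, adding A to F i
-- destroys cross dependence, so ∁ A contains disjoint members of J i and K i. By induction
-- on n, the sets containing disjoint members of up-closed families W and Q are at most as
-- many as the sets Z with Z ∈ W and ∁ Z ∈ Q. For R i = {Z ∣ Z ∈ J i, ∁ Z ∈ K i} this gives
-- 2^n − |F i| ≤ |R i|, and the R i are pairwise disjoint: Z ∈ R i ∩ R j with i < j would
-- yield disjoint members of all the F k. Hence Σ (2^n − |F i|) ≤ 2^n.
module Submission where

open import Defs
open import Data.Nat using (ℕ; zero; suc; _≥_; _*_; _∸_; _^_; _+_)
open import Data.Fin using (Fin)
open import Data.Fin.Subset using (Subset)
open import Data.List using (map; allFin)
open import Data.Nat.ListAction using (sum)

open import Level using (0ℓ)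
import Data.Bool
open import Data.Bool using (Bool; true; false; _∧_; _∨_; not)
open import Data.Empty using (⊥; ⊥-elim)
open import Data.Fin using (zero; suc; _<_)
open import Data.Fin.Properties using (suc-injective; _≟_; _<?_; <-cmp; <⇒≢; <-asym)
open import Data.Fin.Subset using (_∈_; _∉_; _⊆_; _∩_; _∪_; ∁; ⊤; Empty; inside; outside)
  renaming (⊥ to ∅)
open import Data.Fin.Subset.Properties
  using (x∈p∩q⁺; x∈p∩q⁻; x∈p∪q⁺; x∈p∪q⁻; x∈∁p⇒x∉p; x∉p⇒x∈∁p; ∉⊥; ⊆⊤; ⊆-refl;
         out⊆; in⊆in; p∩q⊆p; drop-∷-⊆; drop-∷-Empty)
open import Data.List using (List; []; _∷_; _++_; length; filterᵇ; tabulate)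
open import Data.List.Properties using (map-++; map-∘; map-tabulate)
open import Data.Nat using (_≤_; z≤n; s≤s)
open import Data.Nat.ListAction.Properties using (sum-++)
open import Data.Nat.Properties
  using (≤-refl; ≤-reflexive; +-mono-≤; ∸-monoʳ-≤; <-≤-trans; ≮⇒≥; module ≤-Reasoning;
         +-comm; +-identityʳ; *-identityˡ; *-identityʳ; *-zeroʳ; *-distribʳ-+; *-distribʳ-∸;
         m+n∸n≡m; +-0-monoid; +-commutativeSemigroup)
open import Algebra.Properties.CommutativeSemigroup +-commutativeSemigroup using (interchange)
open import Algebra.Properties.Monoid.Sum +-0-monoid
  using (sum-syntax; sum-cong-≗; sum-replicate-zero) renaming (sum to ∑)
open import Data.Product using (∃-syntax; _×_; _,_; proj₁; proj₂)
open import Data.Sum using (_⊎_; inj₁; inj₂)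
open import Data.Vec using ([]; _∷_; head; here; there)
open import Data.Vec.Properties using (≡-dec)
open import Function using (_∘_; id; flip)
open import Relation.Binary using (tri<; tri≈; tri>)
open import Relation.Binary.PropositionalEquality
  using (_≡_; _≢_; refl; sym; trans; cong; cong₂; ≢-sym; module ≡-Reasoning)
open import Relation.Nullary using (¬_; yes; no; contradiction)
open import Relation.Nullary.Decidable using (decidable-stable)
open import Relation.Unary using (Pred; Decidable; U)

-- Disjointness and indexed unions of subsets

Disjoint : ∀ {n} → Subset n → Subset n → Set
Disjoint p q = Empty (p ∩ q)

module _ {n : ℕ} {p q : Subset n} where

  disjoint : (∀ {x} → x ∈ p → x ∉ q) → Disjoint p q
  disjoint h (x , x∈p∩q) = let x∈p , x∈q = x∈p∩q⁻ p q x∈p∩q in h x∈p x∈q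

  disjoint⁻ : Disjoint p q → ∀ {x} → x ∈ p → x ∉ q
  disjoint⁻ d x∈p x∈q = d (_ , x∈p∩q⁺ (x∈p , x∈q))

Disjoint-sym : ∀ {n} {p q : Subset n} → Disjoint p q → Disjoint q p
Disjoint-sym p#q = disjoint λ x∈q x∈p → disjoint⁻ p#q x∈p x∈q

Empty-outside∷ : ∀ {n} {p : Subset n} → Empty p → Empty (outside ∷ p)
Empty-outside∷ e (suc x , there x∈p) = e (x , x∈p)

⋃ : ∀ {s n} {P : Pred (Fin s) 0ℓ} → Decidable P → (Fin s → Subset n) → Subset n
⋃ {zero} P? A = ∅
⋃ {suc s} P? A with P? zero
... | yes _ = A zero ∪ ⋃ (P? ∘ suc) (A ∘ suc)
... | no _ = ⋃ (P? ∘ suc) (A ∘ suc)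

∈-⋃⁺ : ∀ {s n} {P : Pred (Fin s) 0ℓ} (P? : Decidable P) (A : Fin s → Subset n) {k x} →
  P k → x ∈ A k → x ∈ ⋃ P? A
∈-⋃⁺ P? A {zero} pk x∈ with P? zero
... | yes _ = x∈p∪q⁺ (inj₁ x∈)
... | no ¬p0 = contradiction pk ¬p0
∈-⋃⁺ P? A {suc k} pk x∈ with P? zero
... | yes _ = x∈p∪q⁺ (inj₂ (∈-⋃⁺ (P? ∘ suc) (A ∘ suc) pk x∈))
... | no _ = ∈-⋃⁺ (P? ∘ suc) (A ∘ suc) pk x∈

∈-⋃⁻ : ∀ {s n} {P : Pred (Fin s) 0ℓ} (P? : Decidable P) (A : Fin s → Subset n) {x} →
  x ∈ ⋃ P? A → ∃[ k ] P k × x ∈ A k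
∈-⋃⁻ {zero} P? A x∈ = contradiction x∈ ∉⊥
∈-⋃⁻ {suc s} P? A x∈ with P? zero
... | no _ = let k , pk , x∈Ak = ∈-⋃⁻ (P? ∘ suc) (A ∘ suc) x∈ in suc k , pk , x∈Ak
... | yes p0 with x∈p∪q⁻ (A zero) _ x∈
...   | inj₁ x∈A0 = zero , p0 , x∈A0
...   | inj₂ x∈⋃ = let k , pk , x∈Ak = ∈-⋃⁻ (P? ∘ suc) (A ∘ suc) x∈⋃ in suc k , pk , x∈Ak

-- Indicators and sums over indices and over subsets

χ : Bool → ℕ
χ true = 1
χ false = 0

∨-introˡ : ∀ {x y} → x ≡ true → x ∨ y ≡ true
∨-introˡ refl = refl

∨-introʳ : ∀ {x y} → y ≡ true → x ∨ y ≡ true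
∨-introʳ {true} _ = refl
∨-introʳ {false} y≡true = y≡true

∧-true⁻ : ∀ {x y} → x ∧ y ≡ true → x ≡ true × y ≡ true
∧-true⁻ {true} {true} _ = refl , refl

χ-not-≤ : ∀ {b c} → (b ≡ false → c ≡ true) → χ (not b) ≤ χ c
χ-not-≤ {true} _ = z≤n
χ-not-≤ {false} c≡true rewrite c≡true refl = ≤-refl

χ∨∨+χ≤χ+χ : ∀ x y z → (z ≡ true → x ≡ true) → (z ≡ true → y ≡ true) →
  χ (x ∨ y ∨ z) + χ z ≤ χ x + χ y
χ∨∨+χ≤χ+χ true true true _ _ = ≤-refl
χ∨∨+χ≤χ+χ true true false _ _ = s≤s z≤n
χ∨∨+χ≤χ+χ true false false _ _ = ≤-refl
χ∨∨+χ≤χ+χ false true false _ _ = ≤-refl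
χ∨∨+χ≤χ+χ false false false _ _ = ≤-refl
χ∨∨+χ≤χ+χ _ false true _ z⇒y with () ← z⇒y refl
χ∨∨+χ≤χ+χ false _ true z⇒x _ with () ← z⇒x refl

∑-mono-≤ : ∀ {s} {f g : Fin s → ℕ} → (∀ i → f i ≤ g i) → ∑ f ≤ ∑ g
∑-mono-≤ {zero} f≤g = z≤n
∑-mono-≤ {suc s} f≤g = +-mono-≤ (f≤g zero) (∑-mono-≤ (f≤g ∘ suc))

∑-distrib-+ : ∀ {s} (f g : Fin s → ℕ) → ∑[ i < s ] (f i + g i) ≡ ∑ f + ∑ g
∑-distrib-+ {zero} f g = refl
∑-distrib-+ {suc s} f g = trans (cong (f zero + g zero +_) (∑-distrib-+ (f ∘ suc) (g ∘ suc)))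
  (interchange (f zero) (g zero) (∑ (f ∘ suc)) (∑ (g ∘ suc)))

∑-const : ∀ s c → ∑[ i < s ] c ≡ s * c
∑-const zero c = refl
∑-const (suc s) c = cong (c +_) (∑-const s c)

∑-χ-unique≤1 : ∀ {s} (b : Fin s → Bool) → (∀ {i j} → b i ≡ true → b j ≡ true → i ≡ j) →
  ∑[ i < s ] χ (b i) ≤ 1
∑-χ-unique≤1 {zero} b unique = z≤n
∑-χ-unique≤1 {suc s} b unique with b zero in b0
... | false = ∑-χ-unique≤1 (b ∘ suc) (λ bi bj → suc-injective (unique bi bj))
... | true = ≤-reflexive (cong suc (trans (sum-cong-≗ rest-vanishes) (sum-replicate-zero s)))
  where
  rest-vanishes : ∀ i → χ (b (suc i)) ≡ 0
  rest-vanishes i with b (suc i) in bi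
  ... | false = refl
  ... | true with () ← unique b0 bi

sum-map-allFin : ∀ s (f : Fin s → ℕ) → sum (map f (allFin s)) ≡ ∑ f
sum-map-allFin s f = trans (cong sum (map-tabulate id f)) (sum-tabulate f)
  where
  sum-tabulate : ∀ {s} (f : Fin s → ℕ) → sum (tabulate f) ≡ ∑ f
  sum-tabulate {zero} f = refl
  sum-tabulate {suc s} f = cong (f zero +_) (sum-tabulate (f ∘ suc))

∑ˢ : ∀ {n} → (Subset n → ℕ) → ℕ
∑ˢ {zero} g = g []
∑ˢ {suc n} g = ∑ˢ (g ∘ (outside ∷_)) + ∑ˢ (g ∘ (inside ∷_))

infixl 10 ∑ˢ
syntax ∑ˢ (λ X → e) = ∑ˢ[ X ] e

∑ˢ-mono-≤ : ∀ {n} {g h : Subset n → ℕ} → (∀ X → g X ≤ h X) → ∑ˢ g ≤ ∑ˢ h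
∑ˢ-mono-≤ {zero} g≤h = g≤h []
∑ˢ-mono-≤ {suc n} g≤h =
  +-mono-≤ (∑ˢ-mono-≤ (g≤h ∘ (outside ∷_))) (∑ˢ-mono-≤ (g≤h ∘ (inside ∷_)))

∑ˢ-cong : ∀ {n} {g h : Subset n → ℕ} → (∀ X → g X ≡ h X) → ∑ˢ g ≡ ∑ˢ h
∑ˢ-cong {zero} g≡h = g≡h []
∑ˢ-cong {suc n} g≡h = cong₂ _+_ (∑ˢ-cong (g≡h ∘ (outside ∷_))) (∑ˢ-cong (g≡h ∘ (inside ∷_)))

∑ˢ-distrib-+ : ∀ {n} (g h : Subset n → ℕ) → ∑ˢ[ X ] (g X + h X) ≡ ∑ˢ g + ∑ˢ h
∑ˢ-distrib-+ {zero} g h = refl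
∑ˢ-distrib-+ {suc n} g h =
  trans (cong₂ _+_ (∑ˢ-distrib-+ (g ∘ (outside ∷_)) (h ∘ (outside ∷_)))
                   (∑ˢ-distrib-+ (g ∘ (inside ∷_)) (h ∘ (inside ∷_))))
        (interchange (∑ˢ (g ∘ (outside ∷_))) (∑ˢ (h ∘ (outside ∷_)))
                     (∑ˢ (g ∘ (inside ∷_))) (∑ˢ (h ∘ (inside ∷_))))

∑ˢ-const : ∀ n c → ∑ˢ {n} (λ _ → c) ≡ 2 ^ n * c
∑ˢ-const zero c = sym (+-identityʳ c)
∑ˢ-const (suc n) c = begin
  ∑ˢ {n} (λ _ → c) + ∑ˢ {n} (λ _ → c) ≡⟨ cong₂ _+_ (∑ˢ-const n c) (∑ˢ-const n c) ⟩
  2 ^ n * c + 2 ^ n * c               ≡⟨ cong (2 ^ n * c +_) (cong (_* c) (+-identityʳ (2 ^ n))) ⟨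
  2 ^ n * c + (2 ^ n + 0) * c         ≡⟨ *-distribʳ-+ c (2 ^ n) (2 ^ n + 0) ⟨
  2 ^ suc n * c                       ∎
  where open ≡-Reasoning

∑ˢ-∘∁ : ∀ {n} (g : Subset n → ℕ) → ∑ˢ (g ∘ ∁) ≡ ∑ˢ g
∑ˢ-∘∁ {zero} g = refl
∑ˢ-∘∁ {suc n} g = trans (cong₂ _+_ (∑ˢ-∘∁ (g ∘ (inside ∷_))) (∑ˢ-∘∁ (g ∘ (outside ∷_))))
  (+-comm (∑ˢ (g ∘ (inside ∷_))) (∑ˢ (g ∘ (outside ∷_))))

∑ˢ-∑-comm : ∀ {s n} (g : Fin s → Subset n → ℕ) → ∑ˢ[ X ] ∑[ i < s ] g i X ≡ ∑[ i < s ] ∑ˢ (g i)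
∑ˢ-∑-comm {zero} {n} g = trans (∑ˢ-const n 0) (*-zeroʳ (2 ^ n))
∑ˢ-∑-comm {suc s} g = trans (∑ˢ-distrib-+ (g zero) (λ X → ∑[ i < s ] g (suc i) X))
  (cong (∑ˢ (g zero) +_) (∑ˢ-∑-comm (g ∘ suc)))

sum-map-allSubsets : ∀ n (g : Subset n → ℕ) → sum (map g (allSubsets n)) ≡ ∑ˢ g
sum-map-allSubsets zero g = +-identityʳ (g [])
sum-map-allSubsets (suc n) g = begin
  sum (map g (map (outside ∷_) Xs ++ map (inside ∷_) Xs))
    ≡⟨ cong sum (map-++ g (map (outside ∷_) Xs) (map (inside ∷_) Xs)) ⟩
  sum (map g (map (outside ∷_) Xs) ++ map g (map (inside ∷_) Xs))
    ≡⟨ sum-++ (map g (map (outside ∷_) Xs)) _ ⟩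
  sum (map g (map (outside ∷_) Xs)) + sum (map g (map (inside ∷_) Xs))
    ≡⟨ cong₂ (λ ys zs → sum ys + sum zs) (map-∘ Xs) (map-∘ Xs) ⟨
  sum (map (g ∘ (outside ∷_)) Xs) + sum (map (g ∘ (inside ∷_)) Xs)
    ≡⟨ cong₂ _+_ (sum-map-allSubsets n _) (sum-map-allSubsets n _) ⟩
  ∑ˢ g ∎
  where
  open ≡-Reasoning
  Xs = allSubsets n

length-filterᵇ : ∀ {A : Set} (p : A → Bool) (xs : List A) →
  length (filterᵇ p xs) ≡ sum (map (χ ∘ p) xs)
length-filterᵇ p [] = refl
length-filterᵇ p (x ∷ xs) with p x
... | true = cong suc (length-filterᵇ p xs)
... | false = length-filterᵇ p xs

card≡∑ˢ : ∀ {n} (F : Family n) → card F ≡ ∑ˢ (χ ∘ F)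
card≡∑ˢ {n} F = trans (length-filterᵇ F (allSubsets n)) (sum-map-allSubsets n (χ ∘ F))

missing : ∀ {n} → Family n → ℕ
missing F = ∑ˢ (χ ∘ not ∘ F)

card+missing≡2^n : ∀ {n} (F : Family n) → card F + missing F ≡ 2 ^ n
card+missing≡2^n {n} F = begin
  card F + missing F                  ≡⟨ cong (_+ missing F) (card≡∑ˢ F) ⟩
  ∑ˢ (χ ∘ F) + ∑ˢ (χ ∘ not ∘ F)        ≡⟨ ∑ˢ-distrib-+ (χ ∘ F) (χ ∘ not ∘ F) ⟨
  ∑ˢ[ X ] (χ (F X) + χ (not (F X)))   ≡⟨ ∑ˢ-cong (χ+χ-not ∘ F) ⟩
  ∑ˢ {n} (λ _ → 1)                    ≡⟨ ∑ˢ-const n 1 ⟩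
  2 ^ n * 1                           ≡⟨ *-identityʳ (2 ^ n) ⟩
  2 ^ n                               ∎
  where
  open ≡-Reasoning
  χ+χ-not : ∀ b → χ b + χ (not b) ≡ 1
  χ+χ-not true = refl
  χ+χ-not false = refl

-- Disjoint pairs from two families

UpClosed : ∀ {n} → Family n → Set
UpClosed {n} W = ∀ {X Y : Subset n} → X ⊆ Y → W X ≡ true → W Y ≡ true

_⊑_ : ∀ {n} → Family n → Family n → Set
_⊑_ {n} F G = ∀ {X : Subset n} → F X ≡ true → G X ≡ true

record Join₂ {n} (W Q : Family n) (Y : Subset n) : Set where
  constructor join₂-witness
  field
    left right : Subset n
    left∈W : W left ≡ true
    right∈Q : Q right ≡ true
    left⊆ : left ⊆ Y
    right⊆ : right ⊆ Y
    left#right : Disjoint left right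

-- Decides Join₂ by recursion: the first point of Y lies in the left part, the right part, or neither.
join₂ : ∀ {n} → Family n → Family n → Family n
join₂ {zero} W Q Y = W Y ∧ Q Y
join₂ {suc n} W Q (outside ∷ Y) = join₂ (W ∘ (outside ∷_)) (Q ∘ (outside ∷_)) Y
join₂ {suc n} W Q (inside ∷ Y) =
  join₂ (W ∘ (inside ∷_)) (Q ∘ (outside ∷_)) Y ∨
  join₂ (W ∘ (outside ∷_)) (Q ∘ (inside ∷_)) Y ∨
  join₂ (W ∘ (outside ∷_)) (Q ∘ (outside ∷_)) Y

module _ {n : ℕ} {W Q : Family (suc n)} {Y : Subset n} where

  Join₂-∷-neither : ∀ {y} → Join₂ (W ∘ (outside ∷_)) (Q ∘ (outside ∷_)) Y → Join₂ W Q (y ∷ Y)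
  Join₂-∷-neither (join₂-witness w q w∈ q∈ w⊆ q⊆ w#q) =
    join₂-witness (outside ∷ w) (outside ∷ q) w∈ q∈ (out⊆ w⊆) (out⊆ q⊆) (Empty-outside∷ w#q)

  Join₂-∷-left : Join₂ (W ∘ (inside ∷_)) (Q ∘ (outside ∷_)) Y → Join₂ W Q (inside ∷ Y)
  Join₂-∷-left (join₂-witness w q w∈ q∈ w⊆ q⊆ w#q) =
    join₂-witness (inside ∷ w) (outside ∷ q) w∈ q∈ (in⊆in w⊆) (out⊆ q⊆) (Empty-outside∷ w#q)

  Join₂-∷-right : Join₂ (W ∘ (outside ∷_)) (Q ∘ (inside ∷_)) Y → Join₂ W Q (inside ∷ Y)
  Join₂-∷-right (join₂-witness w q w∈ q∈ w⊆ q⊆ w#q) =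
    join₂-witness (outside ∷ w) (inside ∷ q) w∈ q∈ (out⊆ w⊆) (in⊆in q⊆) (Empty-outside∷ w#q)

  Join₂-tail : ∀ {y} (J : Join₂ W Q (y ∷ Y)) →
    Join₂ (W ∘ (head (Join₂.left J) ∷_)) (Q ∘ (head (Join₂.right J) ∷_)) Y
  Join₂-tail (join₂-witness (a ∷ w) (b ∷ q) w∈ q∈ w⊆ q⊆ w#q) =
    join₂-witness w q w∈ q∈ (drop-∷-⊆ w⊆) (drop-∷-⊆ q⊆) (drop-∷-Empty w#q)

join₂-sound : ∀ {n} (W Q : Family n) (Y : Subset n) → join₂ W Q Y ≡ true → Join₂ W Q Y
join₂-sound {zero} W Q [] h with W [] in w∈ | Q [] in q∈
... | true | true = join₂-witness [] [] w∈ q∈ (λ ()) (λ ()) (λ ())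
join₂-sound {suc n} W Q (outside ∷ Y) h = Join₂-∷-neither (join₂-sound _ _ Y h)
join₂-sound {suc n} W Q (inside ∷ Y) h with join₂ (W ∘ (inside ∷_)) (Q ∘ (outside ∷_)) Y in l
... | true = Join₂-∷-left (join₂-sound _ _ Y l)
... | false with join₂ (W ∘ (outside ∷_)) (Q ∘ (inside ∷_)) Y in r
...   | true = Join₂-∷-right (join₂-sound _ _ Y r)
...   | false = Join₂-∷-neither (join₂-sound _ _ Y h)

join₂-complete : ∀ {n} {W Q : Family n} {Y : Subset n} → Join₂ W Q Y → join₂ W Q Y ≡ true
join₂-complete {zero} {Y = []} (join₂-witness [] [] w∈ q∈ _ _ _) = cong₂ _∧_ w∈ q∈
join₂-complete {suc n} {Y = outside ∷ _} J@(join₂-witness (outside ∷ _) (outside ∷ _) _ _ _ _ _) =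
  join₂-complete (Join₂-tail J)
join₂-complete {suc n} {W} {Q} {inside ∷ Y} J@(join₂-witness (outside ∷ _) (outside ∷ _) _ _ _ _ _) =
  ∨-introʳ {join₂ (W ∘ (inside ∷_)) (Q ∘ (outside ∷_)) Y}
    (∨-introʳ {join₂ (W ∘ (outside ∷_)) (Q ∘ (inside ∷_)) Y} (join₂-complete (Join₂-tail J)))
join₂-complete {suc n} {Y = inside ∷ _} J@(join₂-witness (inside ∷ _) (outside ∷ _) _ _ _ _ _) =
  ∨-introˡ (join₂-complete (Join₂-tail J))
join₂-complete {suc n} {W} {Q} {inside ∷ Y} J@(join₂-witness (outside ∷ _) (inside ∷ _) _ _ _ _ _) =
  ∨-introʳ {join₂ (W ∘ (inside ∷_)) (Q ∘ (outside ∷_)) Y} (∨-introˡ (join₂-complete (Join₂-tail J)))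
join₂-complete {suc n} {Y = inside ∷ _} (join₂-witness (inside ∷ _) (inside ∷ _) _ _ _ _ w#q) =
  contradiction (zero , here) w#q
join₂-complete {suc n} {Y = outside ∷ _} (join₂-witness (inside ∷ _) _ _ _ w⊆ _ _) =
  contradiction (w⊆ here) λ ()
join₂-complete {suc n} {Y = outside ∷ _} (join₂-witness _ (inside ∷ _) _ _ _ q⊆ _) =
  contradiction (q⊆ here) λ ()

join₂-mono : ∀ {n} {W W′ Q Q′ : Family n} → W ⊑ W′ → Q ⊑ Q′ → join₂ W Q ⊑ join₂ W′ Q′
join₂-mono W⊑W′ Q⊑Q′ {Y} j with join₂-sound _ _ Y j
... | join₂-witness w q w∈ q∈ w⊆ q⊆ w#q =
  join₂-complete (join₂-witness w q (W⊑W′ w∈) (Q⊑Q′ q∈) w⊆ q⊆ w#q)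

module _ {n : ℕ} {W : Family (suc n)} (W↑ : UpClosed W) where

  UpClosed-outside∷ : UpClosed (W ∘ (outside ∷_))
  UpClosed-outside∷ X⊆Y = W↑ (out⊆ X⊆Y)

  UpClosed-inside∷ : UpClosed (W ∘ (inside ∷_))
  UpClosed-inside∷ X⊆Y = W↑ (in⊆in X⊆Y)

  outside∷⊑inside∷ : (W ∘ (outside ∷_)) ⊑ (W ∘ (inside ∷_))
  outside∷⊑inside∷ = W↑ (out⊆ ⊆-refl)

splits : ∀ {n} → Family n → Family n → Family n
splits W Q Z = W Z ∧ Q (∁ Z)

-- Split on the first point: the neither-disjunct z of join₂ lies below the other two, so
-- χ (x ∨ y ∨ z) + χ z ≤ χ x + χ y, and x, y are bounded by induction.
∑ˢ-join₂≤∑ˢ-splits : ∀ {n} {W Q : Family n} → UpClosed W → UpClosed Q →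
  ∑ˢ (χ ∘ join₂ W Q) ≤ ∑ˢ (χ ∘ splits W Q)
∑ˢ-join₂≤∑ˢ-splits {zero} W↑ Q↑ = ≤-refl
∑ˢ-join₂≤∑ˢ-splits {suc n} {W} {Q} W↑ Q↑ = begin
  ∑ˢ (χ ∘ z) + ∑ˢ (χ ∘ xyz)                        ≡⟨ +-comm (∑ˢ (χ ∘ z)) _ ⟩
  ∑ˢ (χ ∘ xyz) + ∑ˢ (χ ∘ z)                        ≡⟨ ∑ˢ-distrib-+ (χ ∘ xyz) (χ ∘ z) ⟨
  ∑ˢ[ Y ] (χ (xyz Y) + χ (z Y))                     ≤⟨ ∑ˢ-mono-≤ pointwise ⟩
  ∑ˢ[ Y ] (χ (x Y) + χ (y Y))                       ≡⟨ ∑ˢ-distrib-+ (χ ∘ x) (χ ∘ y) ⟩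
  ∑ˢ (χ ∘ x) + ∑ˢ (χ ∘ y)                          ≤⟨ +-mono-≤ x≤ y≤ ⟩
  ∑ˢ (χ ∘ splits W₁ Q₀) + ∑ˢ (χ ∘ splits W₀ Q₁)    ≡⟨ +-comm (∑ˢ (χ ∘ splits W₁ Q₀)) _ ⟩
  ∑ˢ (χ ∘ splits W₀ Q₁) + ∑ˢ (χ ∘ splits W₁ Q₀)    ∎
  where
  open ≤-Reasoning
  W₀ W₁ Q₀ Q₁ x y z xyz : Family n
  W₀ = W ∘ (outside ∷_)
  W₁ = W ∘ (inside ∷_)
  Q₀ = Q ∘ (outside ∷_)
  Q₁ = Q ∘ (inside ∷_)
  x = join₂ W₁ Q₀
  y = join₂ W₀ Q₁
  z = join₂ W₀ Q₀
  xyz Y = x Y ∨ y Y ∨ z Y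
  pointwise : ∀ Y → χ (xyz Y) + χ (z Y) ≤ χ (x Y) + χ (y Y)
  pointwise Y = χ∨∨+χ≤χ+χ (x Y) (y Y) (z Y)
    (join₂-mono {W = W₀} {W₁} {Q₀} (outside∷⊑inside∷ W↑) id)
    (join₂-mono {W = W₀} {W₀} {Q₀} id (outside∷⊑inside∷ Q↑))
  x≤ : ∑ˢ (χ ∘ x) ≤ ∑ˢ (χ ∘ splits W₁ Q₀)
  x≤ = ∑ˢ-join₂≤∑ˢ-splits (UpClosed-inside∷ W↑) (UpClosed-outside∷ Q↑)
  y≤ : ∑ˢ (χ ∘ y) ≤ ∑ˢ (χ ∘ splits W₀ Q₁)
  y≤ = ∑ˢ-join₂≤∑ˢ-splits (UpClosed-outside∷ W↑) (UpClosed-inside∷ Q↑)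

-- Disjoint choices from several families

record Packing {s n} (F : Fin s → Family n) (P : Pred (Fin s) 0ℓ) (Y : Subset n) : Set where
  constructor packing
  field
    part : Fin s → Subset n
    part∈ : ∀ {k} → P k → F k (part k) ≡ true
    part⊆ : ∀ {k} → P k → part k ⊆ Y
    part#part : ∀ {k l} → P k → P l → k ≢ l → Disjoint (part k) (part l)

open Packing

join : ∀ {s n} → (Fin s → Family n) → {P : Pred (Fin s) 0ℓ} → Decidable P → Family n
join {zero} F P? Y = true
join {suc s} F P? with P? zero
... | yes _ = join₂ (F zero) (join (F ∘ suc) (P? ∘ suc))
... | no _ = join (F ∘ suc) (P? ∘ suc)

module _ {s n : ℕ} {F : Fin s → Family n} {P : Pred (Fin s) 0ℓ} where

  Packing-shrink : ∀ {Y Y′} (A : Packing F P Y) → (∀ {k} → P k → part A k ⊆ Y′) → Packing F P Y′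
  Packing-shrink (packing A A∈ _ A#A) A⊆ = packing A A∈ A⊆ A#A

  Packing-mono : ∀ {Y Y′} → Y ⊆ Y′ → Packing F P Y → Packing F P Y′
  Packing-mono Y⊆Y′ A = Packing-shrink A (λ pk → Y⊆Y′ ∘ part⊆ A pk)

  Packing-restrict : ∀ {Q : Pred (Fin s) 0ℓ} {Y} → (∀ {k} → Q k → P k) → Packing F P Y → Packing F Q Y
  Packing-restrict Q⇒P (packing A A∈ A⊆ A#A) =
    packing A (A∈ ∘ Q⇒P) (A⊆ ∘ Q⇒P) (λ qk ql → A#A (Q⇒P qk) (Q⇒P ql))

module _ {s n : ℕ} {F : Fin (suc s) → Family n} {P : Pred (Fin (suc s)) 0ℓ} {Y : Subset n} where

  Packing-tail : Packing F P Y → Packing (F ∘ suc) (P ∘ suc) Y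
  Packing-tail (packing A A∈ A⊆ A#A) =
    packing (A ∘ suc) A∈ A⊆ (λ pk pl k≢l → A#A pk pl (k≢l ∘ suc-injective))

  Packing-∷ : (w : Subset n) → (P zero → F zero w ≡ true) → (P zero → w ⊆ Y) →
    (B : Packing (F ∘ suc) (P ∘ suc) Y) → (P zero → ∀ {k} → P (suc k) → Disjoint w (part B k)) →
    Packing F P Y
  Packing-∷ w w∈ w⊆ B w#B = packing A A∈ A⊆ A#A
    where
    A : Fin (suc s) → Subset n
    A zero = w
    A (suc k) = part B k
    A∈ : ∀ {k} → P k → F k (A k) ≡ true
    A∈ {zero} = w∈
    A∈ {suc k} = part∈ B
    A⊆ : ∀ {k} → P k → A k ⊆ Y
    A⊆ {zero} = w⊆
    A⊆ {suc k} = part⊆ B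
    A#A : ∀ {k l} → P k → P l → k ≢ l → Disjoint (A k) (A l)
    A#A {zero} {zero} _ _ 0≢0 = contradiction refl 0≢0
    A#A {zero} {suc l} p0 pl _ = w#B p0 pl
    A#A {suc k} {zero} pk p0 _ = Disjoint-sym (w#B p0 pk)
    A#A {suc k} {suc l} pk pl k≢l = part#part B pk pl (k≢l ∘ cong suc)

join-sound : ∀ {s n} (F : Fin s → Family n) {P : Pred (Fin s) 0ℓ} (P? : Decidable P) (Y : Subset n) →
  join F P? Y ≡ true → Packing F P Y
join-sound {zero} F P? Y _ = packing (λ ()) (λ {}) (λ {}) (λ {})
join-sound {suc s} F P? Y j with P? zero
... | no ¬p0 =
  Packing-∷ Y (⊥-elim ∘ ¬p0) (⊥-elim ∘ ¬p0) (join-sound (F ∘ suc) (P? ∘ suc) Y j) (⊥-elim ∘ ¬p0)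
... | yes _ with join₂-sound _ _ Y j
...   | join₂-witness w q w∈ q∈ w⊆ q⊆ w#q =
  Packing-∷ w (λ _ → w∈) (λ _ → w⊆) (Packing-mono q⊆ B)
    (λ _ pk → disjoint λ x∈w x∈Bk → disjoint⁻ w#q x∈w (part⊆ B pk x∈Bk))
  where
  B = join-sound (F ∘ suc) (P? ∘ suc) q q∈

join-complete : ∀ {s n} {F : Fin s → Family n} {P : Pred (Fin s) 0ℓ} (P? : Decidable P) {Y : Subset n} →
  Packing F P Y → join F P? Y ≡ true
join-complete {zero} P? A = refl
join-complete {suc s} P? {Y} A with P? zero
... | no _ = join-complete (P? ∘ suc) (Packing-tail A)
... | yes p0 = join₂-complete
  (join₂-witness w (Y ∩ ∁ w) (part∈ A p0) (join-complete (P? ∘ suc) B) (part⊆ A p0) (p∩q⊆p _ _) w#Y∖w)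
  where
  w = part A zero
  B : Packing _ _ (Y ∩ ∁ w)
  B = Packing-shrink (Packing-tail A) λ pk x∈ →
    x∈p∩q⁺ (part⊆ A pk x∈ , x∉p⇒x∈∁p (disjoint⁻ (part#part A pk p0 λ ()) x∈))
  w#Y∖w : Disjoint w (Y ∩ ∁ w)
  w#Y∖w = disjoint λ {x} x∈w x∈Y∖w → x∈∁p⇒x∉p (proj₂ (x∈p∩q⁻ _ _ x∈Y∖w)) x∈w

join-upClosed : ∀ {s n} (F : Fin s → Family n) {P : Pred (Fin s) 0ℓ} (P? : Decidable P) → UpClosed (join F P?)
join-upClosed F P? X⊆Y j = join-complete P? (Packing-mono X⊆Y (join-sound F P? _ j))

module _ {s n : ℕ} {F : Fin s → Family n} where

  Packing-⋃ : ∀ {P : Pred (Fin s) 0ℓ} (P? : Decidable P) {Y} (A : Packing F P Y) →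
    Packing F P (⋃ P? (part A))
  Packing-⋃ P? A = Packing-shrink A (λ pk → ∈-⋃⁺ P? (part A) pk)

  ⋃-part⊆ : ∀ {P : Pred (Fin s) 0ℓ} (P? : Decidable P) {Y} (A : Packing F P Y) → ⋃ P? (part A) ⊆ Y
  ⋃-part⊆ P? A x∈ = let _ , pk , x∈Ak = ∈-⋃⁻ P? (part A) x∈ in part⊆ A pk x∈Ak

  Packing⇒Join₂ : ∀ {R P Q : Pred (Fin s) 0ℓ} (P? : Decidable P) (Q? : Decidable Q) {Y} →
    (∀ {k} → P k → R k) → (∀ {k} → Q k → R k) → (∀ {k} → P k → ¬ Q k) →
    Packing F R Y → Join₂ (join F P?) (join F Q?) Y
  Packing⇒Join₂ P? Q? P⇒R Q⇒R P⇒¬Q A = join₂-witness w q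
    (join-complete P? (Packing-⋃ P? A₁)) (join-complete Q? (Packing-⋃ Q? A₂))
    (⋃-part⊆ P? A₁) (⋃-part⊆ Q? A₂) (disjoint w#q)
    where
    A₁ = Packing-restrict P⇒R A
    A₂ = Packing-restrict Q⇒R A
    w = ⋃ P? (part A)
    q = ⋃ Q? (part A)
    w#q : ∀ {x} → x ∈ w → x ∉ q
    w#q x∈w x∈q with ∈-⋃⁻ P? (part A) x∈w | ∈-⋃⁻ Q? (part A) x∈q
    ... | k , pk , x∈Ak | l , ql , x∈Al =
      disjoint⁻ (part#part A (P⇒R pk) (Q⇒R ql) (λ { refl → P⇒¬Q pk ql })) x∈Ak x∈Al

  Packing-glue : ∀ {P Q : Pred (Fin s) 0ℓ} (P? : Decidable P) {Y Z} →
    Packing F P Y → Packing F Q Z → Disjoint Y Z → Packing F (λ k → P k ⊎ Q k) (Y ∪ Z)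
  Packing-glue {P} {Q} P? {Y} {Z} A B Y#Z = packing C C∈ C⊆ C#C
    where
    C : Fin s → Subset n
    C k with P? k
    ... | yes _ = part A k
    ... | no _ = part B k
    C∈ : ∀ {k} → P k ⊎ Q k → F k (C k) ≡ true
    C∈ {k} pqk with P? k | pqk
    ... | yes pk | _ = part∈ A pk
    ... | no ¬pk | inj₁ pk = contradiction pk ¬pk
    ... | no _ | inj₂ qk = part∈ B qk
    C⊆ : ∀ {k} → P k ⊎ Q k → C k ⊆ Y ∪ Z
    C⊆ {k} pqk x∈ with P? k | pqk
    ... | yes pk | _ = x∈p∪q⁺ (inj₁ (part⊆ A pk x∈))
    ... | no ¬pk | inj₁ pk = contradiction pk ¬pk
    ... | no _ | inj₂ qk = x∈p∪q⁺ (inj₂ (part⊆ B qk x∈))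
    C#C : ∀ {k l} → P k ⊎ Q k → P l ⊎ Q l → k ≢ l → Disjoint (C k) (C l)
    C#C {k} {l} pqk pql k≢l with P? k | P? l | pqk | pql
    ... | yes pk | yes pl | _ | _ = part#part A pk pl k≢l
    ... | yes pk | no _ | _ | inj₂ ql = disjoint λ x∈Ak x∈Bl →
      disjoint⁻ Y#Z (part⊆ A pk x∈Ak) (part⊆ B ql x∈Bl)
    ... | no _ | yes pl | inj₂ qk | _ = disjoint λ x∈Bk x∈Al →
      disjoint⁻ Y#Z (part⊆ A pl x∈Al) (part⊆ B qk x∈Bk)
    ... | no _ | no _ | inj₂ qk | inj₂ ql = part#part B qk ql k≢l
    ... | _ | no ¬pl | _ | inj₁ pl = contradiction pl ¬pl
    ... | no ¬pk | _ | inj₁ pk | _ = contradiction pk ¬pk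

CrossDependant⇒¬Packing : ∀ {s n} {F : Fin s → Family n} {Y} → CrossDependant F → ¬ Packing F U Y
CrossDependant⇒¬Packing dep A = dep (part A , (λ k → part∈ A _) , (λ k l → part#part A _ _))

-- Cross saturated sequences

module _ {s n : ℕ} (F : Fin s → Family n) where

  addSet-≢ : ∀ {i A k} B → k ≢ i → addSet F i A k B ≡ F k B
  addSet-≢ {i} {k = k} B k≢i with k ≟ i
  ... | yes k≡i = contradiction k≡i k≢i
  ... | no _ = refl

  addSet-≢-set : ∀ {i A B} → B ≢ A → addSet F i A i B ≡ F i B
  addSet-≢-set {i} {A} {B} B≢A with i ≟ i
  ... | no _ = refl
  ... | yes _ with ≡-dec Data.Bool._≟_ B A
  ...   | yes B≡A = contradiction B≡A B≢A
  ...   | no _ = refl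

  J K R : Fin s → Family n
  J i = join F (_<? i)
  K i = join F (i <?_)
  R i = splits (J i) (K i)

  -- A disjoint choice A′ for the extended sequence must pick A′ i = A, as F itself has none;
  -- its other parts then lie in ∁ A and split into those below and those above i.
  saturated⇒join₂ : CrossSaturated F → ∀ {i A} → F i A ≡ false → join₂ (J i) (K i) (∁ A) ≡ true
  saturated⇒join₂ (dep , sat) {i} {A} i∌A =
    decidable-stable (join₂ (J i) (K i) (∁ A) Data.Bool.≟ true) λ ¬join →
      sat i A i∌A λ (A′ , A′∈ , A′#A′) → ¬join (from-extension A′ A′∈ A′#A′)
    where
    from-extension : (A′ : Fin s → Subset n) → (∀ k → addSet F i A k (A′ k) ≡ true) →
      (∀ k l → k ≢ l → Disjoint (A′ k) (A′ l)) → join₂ (J i) (K i) (∁ A) ≡ true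
    from-extension A′ A′∈ A′#A′ with ≡-dec Data.Bool._≟_ (A′ i) A
    ... | no A′i≢A =
      ⊥-elim (CrossDependant⇒¬Packing {F = F} {Y = ⊤} dep
        (packing A′ A′∈F (λ _ → ⊆⊤) (λ _ _ → A′#A′ _ _)))
      where
      A′∈F : ∀ {k} → U k → F k (A′ k) ≡ true
      A′∈F {k} _ with k ≟ i
      ... | yes refl = trans (sym (addSet-≢-set A′i≢A)) (A′∈ i)
      ... | no k≢i = trans (sym (addSet-≢ (A′ k) k≢i)) (A′∈ k)
    ... | yes refl = join₂-complete (Packing⇒Join₂ (_<? i) (i <?_) <⇒≢ (≢-sym ∘ <⇒≢) <-asym others)
      where
      others : Packing F (_≢ i) (∁ (A′ i))
      others = packing A′ (λ {k} k≢i → trans (sym (addSet-≢ (A′ k) k≢i)) (A′∈ k))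
        (λ k≢i x∈ → x∉p⇒x∈∁p (disjoint⁻ (A′#A′ _ _ k≢i) x∈)) (λ _ _ → A′#A′ _ _)

  -- Disjoint members of the F k with k < j inside Z and of those with k > i inside ∁ Z
  -- glue to a disjoint choice from every F k.
  R-disjoint : CrossDependant F → ∀ {Z i j} → i < j → R i Z ≡ true → R j Z ≡ true → ⊥
  R-disjoint dep {Z} {i} {j} i<j RiZ RjZ =
    CrossDependant⇒¬Packing dep (Packing-restrict covers (Packing-glue (_<? j) below above Z#∁Z))
    where
    below : Packing F (_< j) Z
    below = join-sound F (_<? j) Z (proj₁ (∧-true⁻ RjZ))
    above : Packing F (i <_) (∁ Z)
    above = join-sound F (i <?_) (∁ Z) (proj₂ (∧-true⁻ RiZ))
    Z#∁Z : Disjoint Z (∁ Z)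
    Z#∁Z = disjoint λ x∈Z x∈∁Z → x∈∁p⇒x∉p x∈∁Z x∈Z
    covers : ∀ {k} → U k → k < j ⊎ i < k
    covers {k} _ with k <? j
    ... | yes k<j = inj₁ k<j
    ... | no k≮j = inj₂ (<-≤-trans i<j (≮⇒≥ k≮j))

  R-unique : CrossDependant F → ∀ {Z i j} → R i Z ≡ true → R j Z ≡ true → i ≡ j
  R-unique dep {i = i} {j} RiZ RjZ with <-cmp i j
  ... | tri< i<j _ _ = ⊥-elim (R-disjoint dep i<j RiZ RjZ)
  ... | tri≈ _ i≡j _ = i≡j
  ... | tri> _ _ j<i = ⊥-elim (R-disjoint dep j<i RjZ RiZ)

  ∑-card+∑-missing : ∑[ i < s ] card (F i) + ∑[ i < s ] missing (F i) ≡ s * 2 ^ n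
  ∑-card+∑-missing = begin
    ∑[ i < s ] card (F i) + ∑[ i < s ] missing (F i) ≡⟨ ∑-distrib-+ (card ∘ F) (missing ∘ F) ⟨
    ∑[ i < s ] (card (F i) + missing (F i))         ≡⟨ sum-cong-≗ (card+missing≡2^n ∘ F) ⟩
    ∑[ i < s ] (2 ^ n)                              ≡⟨ ∑-const s (2 ^ n) ⟩
    s * 2 ^ n                                       ∎
    where open ≡-Reasoning

  ∑-missing≤2^n : CrossSaturated F → ∑[ i < s ] missing (F i) ≤ 2 ^ n
  ∑-missing≤2^n saturated@(dep , _) = begin
    ∑[ i < s ] missing (F i)        ≤⟨ ∑-mono-≤ missing≤∑ˢR ⟩
    ∑[ i < s ] ∑ˢ (χ ∘ R i)         ≡⟨ ∑ˢ-∑-comm (λ i → χ ∘ R i) ⟨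
    ∑ˢ[ Z ] ∑[ i < s ] χ (R i Z)    ≤⟨ ∑ˢ-mono-≤ (λ Z → ∑-χ-unique≤1 (flip R Z) (R-unique dep)) ⟩
    ∑ˢ {n} (λ _ → 1)                ≡⟨ ∑ˢ-const n 1 ⟩
    2 ^ n * 1                       ≡⟨ *-identityʳ (2 ^ n) ⟩
    2 ^ n                           ∎
    where
    open ≤-Reasoning
    missing≤∑ˢR : ∀ i → missing (F i) ≤ ∑ˢ (χ ∘ R i)
    missing≤∑ˢR i = begin
      missing (F i)                  ≤⟨ ∑ˢ-mono-≤ (λ A → χ-not-≤ (saturated⇒join₂ saturated {i} {A})) ⟩
      ∑ˢ (χ ∘ join₂ (J i) (K i) ∘ ∁) ≡⟨ ∑ˢ-∘∁ (χ ∘ join₂ (J i) (K i)) ⟩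
      ∑ˢ (χ ∘ join₂ (J i) (K i))
        ≤⟨ ∑ˢ-join₂≤∑ˢ-splits (join-upClosed F (_<? i)) (join-upClosed F (i <?_)) ⟩
      ∑ˢ (χ ∘ R i)                   ∎

-- The bound holds for all s and n; the hypotheses s ≥ 2 and n ≥ 1 are unused.
theorem1p5 : (s n : ℕ) → s ≥ 2 → n ≥ 1 → (F : Fin s → Family n) →
    CrossSaturated F →
    sum (map (λ i → card (F i)) (allFin s)) ≥ (s ∸ 1) * 2 ^ n
theorem1p5 s n _ _ F saturated = begin
  (s ∸ 1) * 2 ^ n                ≡⟨ *-distribʳ-∸ (2 ^ n) s 1 ⟩
  s * 2 ^ n ∸ 1 * 2 ^ n          ≡⟨ cong (s * 2 ^ n ∸_) (*-identityˡ (2 ^ n)) ⟩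
  s * 2 ^ n ∸ 2 ^ n              ≤⟨ ∸-monoʳ-≤ (s * 2 ^ n) (∑-missing≤2^n F saturated) ⟩
  s * 2 ^ n ∸ ∑ missings         ≡⟨ cong (_∸ ∑ missings) (∑-card+∑-missing F) ⟨
  ∑ cards + ∑ missings ∸ ∑ missings ≡⟨ m+n∸n≡m (∑ cards) (∑ missings) ⟩
  ∑ cards                        ≡⟨ sum-map-allFin s cards ⟨
  sum (map cards (allFin s))     ∎
  where
  open ≤-Reasoning
  cards missings : Fin s → ℕ
  cards = card ∘ F
  missings = missing ∘ F
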